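{- For all $n\ge1$, $$\sum_{i=n}^{2n-1}\frac{(-1)^{n+i}}{i}\binom{i}{n}\binom{3n}{i+1+n}=\frac{1}{n+1}\binom{2n}{n}.$$ -}

module Defs where

open import Data.Nat using (ℕ; zero; suc; _+_; _*_; _∸_)
open import Data.Nat.Combinatorics using (_C_)
open import Data.Integer using (ℤ; +_; -_)
open import Data.Rational using (ℚ; _/_; 0ℚ)
import Data.Rational as ℚ

sign : ℕ → ℤ
sign zero = + 1
sign (suc k) = - sign k

-- Summand  (-1)^(n+i) / i * C(i,n) * C(3n, i+1+n)  as a rational.
-- The case i = 0 never occurs in the sum (i ≥ n ≥ 1); it is set to 0
-- only to make the division total.
term : ℕ → ℕ → ℚ
term n zero = 0ℚ
term n (suc j) =
  (sign (n + suc j) Data.Integer.* (+ ((suc j C n) * ((3 * n) C (suc j + 1 + n))))) / suc j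

sumFrom : ℕ → ℕ → (ℕ → ℚ) → ℚ
sumFrom a zero f = 0ℚ
sumFrom a (suc len) f = f a ℚ.+ sumFrom (suc a) len f

sumRange : ℕ → (ℕ → ℚ) → ℚ
sumRange n f = sumFrom n n f

{-# OPTIONS --safe #-}
module Submission where

-- Write i = n + k.  Since i⁻¹ C(i, n) = n⁻¹ C(n-1+k, n-1) and
-- C(3n, 2n+1+k) = C(3n, n-1-k), the sum is n⁻¹ times the coefficient of
-- x^(n-1) in (1 + x)^(-n) (1 + x)^(3n) = (1 + x)^(2n), where
-- (1 + x)^(-n) = Σ_k (-1)^k C(n-1+k, n-1) x^k.  Hence it equals
-- C(2n, n-1)/n = C(2n, n)/(n+1).  The product identity
-- (1 + x)^(-a) (1 + x)^(a+N) = (1 + x)^N follows by induction on a from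
-- (1 + x)^(N+1) = (1 + x)^N + x (1 + x)^N and the matching recurrence
-- (1 + x)^(-a-1) + x (1 + x)^(-a-1) = (1 + x)^(-a).

module Binomial where

  open import Data.Nat.Base using (ℕ; zero; suc; _+_; _*_)
  open import Data.Nat.Properties
    using (m≤m+n; m+n∸m≡n; +-comm; +-cancelʳ-≡; *-identityˡ; *-identityʳ; *-distribʳ-+)
  open import Data.Nat.Combinatorics
    using (_C_; nCk≡nC[n∸k]; nC1≡n; nCk+nC[k+1]≡[n+1]C[k+1])
  open import Data.Nat.Tactic.RingSolver using (solve-∀)
  open import Relation.Binary.PropositionalEquality
  open ≡-Reasoning

  C-sym : ∀ {n} a b → a + b ≡ n → n C a ≡ n C b
  C-sym a b refl = trans (nCk≡nC[n∸k] (m≤m+n a b)) (cong ((a + b) C_) (m+n∸m≡n a b))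

  [n+1]C[k+1]*[k+1]≡nCk*[n+1] : ∀ n k → (suc n C suc k) * suc k ≡ (n C k) * suc n
  [n+1]C[k+1]*[k+1]≡nCk*[n+1] n zero =
    trans (*-identityʳ (suc n C 1)) (trans (nC1≡n (suc n)) (sym (*-identityˡ (suc n))))
  [n+1]C[k+1]*[k+1]≡nCk*[n+1] zero (suc k) = refl
  [n+1]C[k+1]*[k+1]≡nCk*[n+1] (suc n) (suc k) = begin
    (suc (suc n) C suc (suc k)) * suc (suc k)
      ≡⟨ cong (_* suc (suc k)) (sym (nCk+nC[k+1]≡[n+1]C[k+1] (suc n) (suc k))) ⟩
    (a + b) * suc (suc k)
      ≡⟨ split a b k ⟩
    a * suc k + a + b * suc (suc k)
      ≡⟨ cong₂ (λ x y → x + a + y) ([n+1]C[k+1]*[k+1]≡nCk*[n+1] n k)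
                                   ([n+1]C[k+1]*[k+1]≡nCk*[n+1] n (suc k)) ⟩
    (n C k) * suc n + a + (n C suc k) * suc n
      ≡⟨ regroup (n C k) (n C suc k) a n ⟩
    ((n C k) + (n C suc k)) * suc n + a
      ≡⟨ cong (λ x → x * suc n + a) (nCk+nC[k+1]≡[n+1]C[k+1] n k) ⟩
    a * suc n + a
      ≡⟨ merge a n ⟩
    a * suc (suc n) ∎
    where
    a = suc n C suc k
    b = suc n C suc (suc k)
    split : ∀ a b k → (a + b) * suc (suc k) ≡ a * suc k + a + b * suc (suc k)
    split = solve-∀
    regroup : ∀ x y a n → x * suc n + a + y * suc n ≡ (x + y) * suc n + a
    regroup = solve-∀
    merge : ∀ a n → a * suc n + a ≡ a * suc (suc n)
    merge = solve-∀

  nC[k+1]*[k+1]+nCk*[k+1]≡nCk*[n+1] :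
    ∀ n k → (n C suc k) * suc k + (n C k) * suc k ≡ (n C k) * suc n
  nC[k+1]*[k+1]+nCk*[k+1]≡nCk*[n+1] n k = begin
    (n C suc k) * suc k + (n C k) * suc k ≡⟨ sym (*-distribʳ-+ (suc k) (n C suc k) (n C k)) ⟩
    ((n C suc k) + (n C k)) * suc k      ≡⟨ cong (_* suc k) (+-comm (n C suc k) (n C k)) ⟩
    ((n C k) + (n C suc k)) * suc k      ≡⟨ cong (_* suc k) (nCk+nC[k+1]≡[n+1]C[k+1] n k) ⟩
    (suc n C suc k) * suc k              ≡⟨ [n+1]C[k+1]*[k+1]≡nCk*[n+1] n k ⟩
    (n C k) * suc n                      ∎

  2nC[n-1]*[n+1]≡2nCn*n :
    ∀ m → ((2 * suc m) C m) * suc (suc m) ≡ ((2 * suc m) C suc m) * suc m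
  2nC[n-1]*[n+1]≡2nCn*n m = +-cancelʳ-≡ (c * suc m) _ _ (begin
    c * suc (suc m) + c * suc m          ≡⟨ split c m ⟩
    c * suc (2 * suc m)                  ≡⟨ nC[k+1]*[k+1]+nCk*[k+1]≡nCk*[n+1] (2 * suc m) m ⟨
    c′ * suc m + c * suc m               ∎)
    where
    c = (2 * suc m) C m
    c′ = (2 * suc m) C suc m
    split : ∀ c m → c * suc (suc m) + c * suc m ≡ c * suc (2 * suc m)
    split = solve-∀

module PowerSeries where

  open import Data.Nat.Base as ℕ using (ℕ; zero; suc)
  open import Data.Nat.Combinatorics using (_C_; nCn≡1; nCk+nC[k+1]≡[n+1]C[k+1])
  import Data.Nat.Properties as ℕ
  open import Data.Integer.Base using (ℤ; +_; -_; 0ℤ; 1ℤ; _+_; _*_)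
  open import Data.Integer.Properties
  open import Data.Integer.Tactic.RingSolver using (solve-∀)
  open import Function.Base using (_∘_)
  open import Relation.Binary.PropositionalEquality
  open ≡-Reasoning
  open import Defs using (sign)

  Series : Set
  Series = ℕ → ℤ

  infixl 6 _⊕_
  infixl 7 _⋆_

  _⊕_ : Series → Series → Series
  (f ⊕ g) k = f k + g k

  -- The Cauchy product: (f ⋆ g) j = Σ_{i ≤ j} f i * g (j ∸ i).
  _⋆_ : Series → Series → Series
  (f ⋆ g) zero    = f 0 * g 0
  (f ⋆ g) (suc j) = f 0 * g (suc j) + (f ∘ suc ⋆ g) j

  0ₛ : Series
  0ₛ _ = 0ℤ

  1ₛ : Series
  1ₛ zero    = 1ℤ
  1ₛ (suc _) = 0ℤ

  shift : Series → Series
  shift f zero    = 0ℤ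
  shift f (suc k) = f k

  ⋆-congˡ : ∀ {f f′} g → f ≗ f′ → f ⋆ g ≗ f′ ⋆ g
  ⋆-congˡ g f≗f′ zero    = cong (_* g 0) (f≗f′ 0)
  ⋆-congˡ g f≗f′ (suc j) =
    cong₂ _+_ (cong (_* g (suc j)) (f≗f′ 0)) (⋆-congˡ g (f≗f′ ∘ suc) j)

  ⋆-congʳ : ∀ f {g g′} → g ≗ g′ → f ⋆ g ≗ f ⋆ g′
  ⋆-congʳ f g≗g′ zero    = cong (f 0 *_) (g≗g′ 0)
  ⋆-congʳ f g≗g′ (suc j) =
    cong₂ _+_ (cong (f 0 *_) (g≗g′ (suc j))) (⋆-congʳ (f ∘ suc) g≗g′ j)

  private
    interchange : ∀ a b c d → (a + b) + (c + d) ≡ (a + c) + (b + d)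
    interchange = solve-∀

  ⋆-distribˡ-⊕ : ∀ f g h → f ⋆ (g ⊕ h) ≗ f ⋆ g ⊕ f ⋆ h
  ⋆-distribˡ-⊕ f g h zero    = *-distribˡ-+ (f 0) (g 0) (h 0)
  ⋆-distribˡ-⊕ f g h (suc j) = trans
    (cong₂ _+_ (*-distribˡ-+ (f 0) (g (suc j)) (h (suc j))) (⋆-distribˡ-⊕ (f ∘ suc) g h j))
    (interchange (f 0 * g (suc j)) (f 0 * h (suc j)) ((f ∘ suc ⋆ g) j) ((f ∘ suc ⋆ h) j))

  ⋆-distribʳ-⊕ : ∀ f g h → (f ⊕ g) ⋆ h ≗ f ⋆ h ⊕ g ⋆ h
  ⋆-distribʳ-⊕ f g h zero    = *-distribʳ-+ (h 0) (f 0) (g 0)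
  ⋆-distribʳ-⊕ f g h (suc j) = trans
    (cong₂ _+_ (*-distribʳ-+ (h (suc j)) (f 0) (g 0)) (⋆-distribʳ-⊕ (f ∘ suc) (g ∘ suc) h j))
    (interchange (f 0 * h (suc j)) (g 0 * h (suc j)) ((f ∘ suc ⋆ h) j) ((g ∘ suc ⋆ h) j))

  shift-⋆ : ∀ f g → shift f ⋆ g ≗ shift (f ⋆ g)
  shift-⋆ f g zero    = refl
  shift-⋆ f g (suc j) = +-identityˡ ((f ⋆ g) j)

  ⋆-shift : ∀ f g → f ⋆ shift g ≗ shift (f ⋆ g)
  ⋆-shift f g zero          = *-zeroʳ (f 0)
  ⋆-shift f g (suc zero)    =
    trans (cong (_+_ (f 0 * g 0)) (*-zeroʳ (f 1))) (+-identityʳ (f 0 * g 0))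
  ⋆-shift f g (suc (suc j)) = cong (_+_ (f 0 * g (suc j))) (⋆-shift (f ∘ suc) g (suc j))

  0ₛ-⋆ : ∀ g → 0ₛ ⋆ g ≗ 0ₛ
  0ₛ-⋆ g zero    = refl
  0ₛ-⋆ g (suc j) = cong (_+_ 0ℤ) (0ₛ-⋆ g j)

  1ₛ-⋆ : ∀ g → 1ₛ ⋆ g ≗ g
  1ₛ-⋆ g zero    = *-identityˡ (g 0)
  1ₛ-⋆ g (suc j) =
    trans (cong₂ _+_ (*-identityˡ (g (suc j))) (0ₛ-⋆ g j)) (+-identityʳ (g (suc j)))

  sign-double-+ : ∀ a k → sign (a ℕ.+ (a ℕ.+ k)) ≡ sign k
  sign-double-+ zero    k = refl
  sign-double-+ (suc a) k = begin
    - sign (a ℕ.+ suc (a ℕ.+ k))  ≡⟨ cong (-_ ∘ sign) (ℕ.+-suc a (a ℕ.+ k)) ⟩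
    - - sign (a ℕ.+ (a ℕ.+ k))    ≡⟨ neg-involutive _ ⟩
    sign (a ℕ.+ (a ℕ.+ k))        ≡⟨ sign-double-+ a k ⟩
    sign k                        ∎

  binom : ℕ → Series
  binom N k = + (N C k)

  -- the coefficients of (1 + x) ^ (- a)
  negBinom : ℕ → Series
  negBinom zero    = 1ₛ
  negBinom (suc a) k = sign k * + ((a ℕ.+ k) C a)

  binom-pascal : ∀ N → binom (suc N) ≗ binom N ⊕ shift (binom N)
  binom-pascal N zero    = refl
  binom-pascal N (suc k) = begin
    + (suc N C suc k)            ≡⟨ cong +_ (nCk+nC[k+1]≡[n+1]C[k+1] N k) ⟨
    + ((N C k) ℕ.+ (N C suc k))  ≡⟨ cong +_ (ℕ.+-comm (N C k) (N C suc k)) ⟩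
    + ((N C suc k) ℕ.+ (N C k))  ≡⟨ pos-+ (N C suc k) (N C k) ⟩
    + (N C suc k) + + (N C k)    ∎

  negBinom-0 : ∀ a → negBinom a 0 ≡ 1ℤ
  negBinom-0 zero    = refl
  negBinom-0 (suc a) = begin
    1ℤ * + ((a ℕ.+ 0) C a)  ≡⟨ *-identityˡ _ ⟩
    + ((a ℕ.+ 0) C a)       ≡⟨ cong (λ n → + (n C a)) (ℕ.+-identityʳ a) ⟩
    + (a C a)               ≡⟨ cong +_ (nCn≡1 a) ⟩
    1ℤ                      ∎

  negBinom-pascal : ∀ a → negBinom (suc a) ⊕ shift (negBinom (suc a)) ≗ negBinom a
  negBinom-pascal a zero =
    trans (+-identityʳ _) (trans (negBinom-0 (suc a)) (sym (negBinom-0 a)))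
  negBinom-pascal zero (suc k) = trans
    (cong (_+ sign k * + 1) (sym (neg-distribˡ-* (sign k) (+ 1))))
    (+-inverseˡ (sign k * + 1))
  negBinom-pascal (suc a) (suc k) = begin
    - s * + (suc (a ℕ.+ suc k) C suc a) + s * + (suc (a ℕ.+ k) C suc a)
      ≡⟨ cong₂ (λ x y → - s * + x + s * + y)
           (sym (nCk+nC[k+1]≡[n+1]C[k+1] (a ℕ.+ suc k) a))
           (cong (_C suc a) (sym (ℕ.+-suc a k))) ⟩
    - s * + (p ℕ.+ q) + s * + q
      ≡⟨ cong (λ x → - s * x + s * + q) (pos-+ p q) ⟩
    - s * (+ p + + q) + s * + q
      ≡⟨ cancel s (+ p) (+ q) ⟩
    - s * + p ∎
    where
    s = sign k
    p = (a ℕ.+ suc k) C a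
    q = (a ℕ.+ suc k) C suc a
    cancel : ∀ s p q → - s * (p + q) + s * q ≡ - s * p
    cancel = solve-∀

  negBinom-⋆-binom : ∀ a N → negBinom a ⋆ binom (a ℕ.+ N) ≗ binom N
  negBinom-⋆-binom zero    N   = 1ₛ-⋆ (binom N)
  negBinom-⋆-binom (suc a) N j = begin
    (f ⋆ binom (suc (a ℕ.+ N))) j  ≡⟨ ⋆-congʳ f (binom-pascal (a ℕ.+ N)) j ⟩
    (f ⋆ (g ⊕ shift g)) j          ≡⟨ ⋆-distribˡ-⊕ f g (shift g) j ⟩
    (f ⋆ g) j + (f ⋆ shift g) j    ≡⟨ cong (_+_ ((f ⋆ g) j)) (⋆-shift f g j) ⟩
    (f ⋆ g) j + shift (f ⋆ g) j    ≡⟨ cong (_+_ ((f ⋆ g) j)) (shift-⋆ f g j) ⟨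
    (f ⋆ g) j + (shift f ⋆ g) j    ≡⟨ ⋆-distribʳ-⊕ f (shift f) g j ⟨
    ((f ⊕ shift f) ⋆ g) j          ≡⟨ ⋆-congˡ g (negBinom-pascal a) j ⟩
    (negBinom a ⋆ g) j             ≡⟨ negBinom-⋆-binom a N j ⟩
    binom N j                      ∎
    where
    f = negBinom (suc a)
    g = binom (a ℕ.+ N)

open import Data.Nat.Base using (ℕ; zero; suc; _+_; _*_; _≤_; NonZero)
import Data.Nat.Properties as ℕ
import Data.Nat.Tactic.RingSolver as ℕ-Ring
open import Data.Nat.Combinatorics using (_C_)
open import Data.Integer.Base as ℤ using (ℤ; +_)
import Data.Integer.Properties as ℤ
import Data.Integer.Tactic.RingSolver as ℤ-Ring
open import Data.Rational.Base as ℚ using (ℚ; _/_; 0ℚ)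
import Data.Rational.Properties as ℚ
import Data.Rational.Unnormalised.Base as ℚᵘ
import Data.Rational.Unnormalised.Properties as ℚᵘ
open import Function.Base using (_∘_)
open import Relation.Binary.PropositionalEquality
open import Defs
open Binomial
open PowerSeries using (_⋆_; binom; negBinom; negBinom-⋆-binom; sign-double-+)

pos-*-cong : ∀ a b c d → a * b ≡ c * d → + a ℤ.* + b ≡ + c ℤ.* + d
pos-*-cong a b c d eq = trans (sym (ℤ.pos-* a b)) (trans (cong +_ eq) (ℤ.pos-* c d))

*≡*⇒/≡/ : ∀ p q m n .{{_ : NonZero m}} .{{_ : NonZero n}} →
          p ℤ.* + n ≡ q ℤ.* + m → p / m ≡ q / n
*≡*⇒/≡/ p q (suc m) (suc n) eq = ℚ.fromℚᵘ-cong {ℚᵘ.mkℚᵘ p m} {ℚᵘ.mkℚᵘ q n} (ℚᵘ.*≡* eq)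

/-distribʳ-+ : ∀ p q n .{{_ : NonZero n}} → p / n ℚ.+ q / n ≡ (p ℤ.+ q) / n
/-distribʳ-+ p q n@(suc n-1) = ℚ.toℚᵘ-injective (begin
  ℚ.toℚᵘ (p / n ℚ.+ q / n)
    ≈⟨ ℚ.toℚᵘ-homo-+ (p / n) (q / n) ⟩
  ℚ.toℚᵘ (p / n) ℚᵘ.+ ℚ.toℚᵘ (q / n)
    ≈⟨ ℚᵘ.+-cong (ℚ.toℚᵘ-fromℚᵘ (ℚᵘ.mkℚᵘ p n-1)) (ℚ.toℚᵘ-fromℚᵘ (ℚᵘ.mkℚᵘ q n-1)) ⟩
  ℚᵘ.mkℚᵘ p n-1 ℚᵘ.+ ℚᵘ.mkℚᵘ q n-1
    ≈⟨ ℚᵘ.*≡* cross-multiplied ⟩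
  ℚᵘ.mkℚᵘ (p ℤ.+ q) n-1
    ≈⟨ ℚ.toℚᵘ-fromℚᵘ (ℚᵘ.mkℚᵘ (p ℤ.+ q) n-1) ⟨
  ℚ.toℚᵘ ((p ℤ.+ q) / n) ∎)
  where
  open ℚᵘ.≃-Reasoning
  common-denominator : ∀ p q n → (p ℤ.* n ℤ.+ q ℤ.* n) ℤ.* n ≡ (p ℤ.+ q) ℤ.* (n ℤ.* n)
  common-denominator = ℤ-Ring.solve-∀
  cross-multiplied : (p ℤ.* + n ℤ.+ q ℤ.* + n) ℤ.* + n ≡ (p ℤ.+ q) ℤ.* + (n * n)
  cross-multiplied =
    trans (common-denominator p q (+ n)) (cong ((p ℤ.+ q) ℤ.*_) (sym (ℤ.pos-* n n)))

sumFrom-⋆ : ∀ (h : ℕ → ℚ) (f g : ℕ → ℤ) n .{{_ : NonZero n}} a d →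
            (∀ k e → k + e ≡ d → h (a + k) ≡ (f k ℤ.* g e) / n) →
            sumFrom a (suc d) h ≡ (f ⋆ g) d / n
sumFrom-⋆ h f g n a zero hyp = begin
  h a ℚ.+ 0ℚ         ≡⟨ ℚ.+-identityʳ (h a) ⟩
  h a                ≡⟨ cong h (ℕ.+-identityʳ a) ⟨
  h (a + 0)          ≡⟨ hyp 0 0 refl ⟩
  (f 0 ℤ.* g 0) / n  ∎
  where open ≡-Reasoning
sumFrom-⋆ h f g n a (suc d) hyp = begin
  h a ℚ.+ sumFrom (suc a) (suc d) h
    ≡⟨ cong₂ ℚ._+_ first (sumFrom-⋆ h (f ∘ suc) g n (suc a) d rest) ⟩
  (f 0 ℤ.* g (suc d)) / n ℚ.+ (f ∘ suc ⋆ g) d / n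
    ≡⟨ /-distribʳ-+ (f 0 ℤ.* g (suc d)) ((f ∘ suc ⋆ g) d) n ⟩
  (f ⋆ g) (suc d) / n ∎
  where
  open ≡-Reasoning
  first : h a ≡ (f 0 ℤ.* g (suc d)) / n
  first = trans (cong h (sym (ℕ.+-identityʳ a))) (hyp 0 (suc d) refl)
  rest : ∀ k e → k + e ≡ d → h (suc a + k) ≡ (f (suc k) ℤ.* g e) / n
  rest k e k+e≡d = trans (cong h (sym (ℕ.+-suc a k))) (hyp (suc k) e (cong suc k+e≡d))

term-factorises : ∀ m k d → k + d ≡ m →
  term (suc m) (suc m + k) ≡ (negBinom (suc m) k ℤ.* binom (3 * suc m) d) / suc m
term-factorises m k d refl =
  *≡*⇒/≡/ (sign (suc m + suc (m + k)) ℤ.* + (X * Y)) (sign k ℤ.* + Z ℤ.* + W)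
          (suc (m + k)) (suc m) (begin
  sign (suc m + suc (m + k)) ℤ.* + (X * Y) ℤ.* + suc m
    ≡⟨ cong₂ (λ s y → s ℤ.* + (X * y) ℤ.* + suc m)
             (sign-double-+ (suc m) k) (C-sym _ d (complement k d)) ⟩
  sign k ℤ.* + (X * W) ℤ.* + suc m
    ≡⟨ cong (λ x → sign k ℤ.* x ℤ.* + suc m) (ℤ.pos-* X W) ⟩
  sign k ℤ.* (+ X ℤ.* + W) ℤ.* + suc m
    ≡⟨ reorderˡ (sign k) (+ X) (+ W) (+ suc m) ⟩
  sign k ℤ.* + W ℤ.* (+ X ℤ.* + suc m)
    ≡⟨ cong (sign k ℤ.* + W ℤ.*_)
            (pos-*-cong X (suc m) Z (suc (m + k)) ([n+1]C[k+1]*[k+1]≡nCk*[n+1] (m + k) m)) ⟩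
  sign k ℤ.* + W ℤ.* (+ Z ℤ.* + suc (m + k))
    ≡⟨ reorderʳ (sign k) (+ W) (+ Z) (+ suc (m + k)) ⟩
  sign k ℤ.* + Z ℤ.* + W ℤ.* + suc (m + k) ∎)
  where
  open ≡-Reasoning
  X = suc (m + k) C suc m
  Y = (3 * suc m) C (suc (m + k) + 1 + suc m)
  W = (3 * suc m) C d
  Z = (m + k) C m
  complement : ∀ k d → suc (k + d + k) + 1 + suc (k + d) + d ≡ 3 * suc (k + d)
  complement = ℕ-Ring.solve-∀
  reorderˡ : ∀ s x w n → s ℤ.* (x ℤ.* w) ℤ.* n ≡ s ℤ.* w ℤ.* (x ℤ.* n)
  reorderˡ = ℤ-Ring.solve-∀
  reorderʳ : ∀ s w z n → s ℤ.* w ℤ.* (z ℤ.* n) ≡ s ℤ.* z ℤ.* w ℤ.* n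
  reorderʳ = ℤ-Ring.solve-∀

C[2n,n-1]/n≡C[2n,n]/[n+1] :
  ∀ m → + ((2 * suc m) C m) / suc m ≡ + ((2 * suc m) C suc m) / suc (suc m)
C[2n,n-1]/n≡C[2n,n]/[n+1] m =
  *≡*⇒/≡/ (+ ((2 * suc m) C m)) (+ ((2 * suc m) C suc m)) (suc m) (suc (suc m))
  (pos-*-cong ((2 * suc m) C m) (suc (suc m)) ((2 * suc m) C suc m) (suc m) (2nC[n-1]*[n+1]≡2nCn*n m))

corollary1 : (n : ℕ) → 1 ≤ n →
    sumRange n (term n) ≡ (+ ((2 * n) C n)) / suc n
corollary1 (suc m) _ = begin
  sumFrom (suc m) (suc m) (term (suc m))
    ≡⟨ sumFrom-⋆ (term (suc m)) (negBinom (suc m)) (binom (3 * suc m)) (suc m) (suc m) m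
                 (term-factorises m) ⟩
  (negBinom (suc m) ⋆ binom (suc m + 2 * suc m)) m / suc m
    ≡⟨ cong (_/ suc m) (negBinom-⋆-binom (suc m) (2 * suc m) m) ⟩
  + ((2 * suc m) C m) / suc m
    ≡⟨ C[2n,n-1]/n≡C[2n,n]/[n+1] m ⟩
  + ((2 * suc m) C suc m) / suc (suc m) ∎
  where open ≡-Reasoning
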